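{- Let $G=(V,E)$ be a finite undirected graph with a matching $M$ such that at least one vertex is unmatched. If $(u,v)\in M$ is a matched edge, then $t(u)=t(v)=t(u,v)$.
   Context: An alternating path is a simple path whose edges alternate between edges not in $M$ (unmatched edges) and edges in $M$ (matched edges); an alternating path starting at a vertex not covered by $M$ (an unmatched vertex) begins with an unmatched edge. For a vertex $v$, $\mathrm{evenlevel}(v)$ (resp. $\mathrm{oddlevel}(v)$) is the minimum length of an even (resp. odd) length alternating path from some unmatched vertex to $v$, and is $\infty$ if there is no such path. The tenacity of a vertex is $t(v)=\mathrm{evenlevel}(v)+\mathrm{oddlevel}(v)$. The tenacity of an unmatched edge $(u,v)$ is $t(u,v)=\mathrm{evenlevel}(u)+\mathrm{evenlevel}(v)+1$, and of a matched edge $(u,v)$ is $t(u,v)=\mathrm{oddlevel}(u)+\mathrm{oddlevel}(v)+1$. -}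

module Defs where

open import Data.Nat using (ℕ; zero; suc; _+_; _≤_; _%_)
open import Data.Fin using (Fin; zero; suc; toℕ; fromℕ; inject₁)
open import Data.Vec using (Vec; lookup)
open import Data.Product using (Σ; ∃; _×_)
open import Data.Empty using (⊥)
open import Relation.Nullary using (¬_)
open import Relation.Binary.PropositionalEquality using (_≡_)
open import Function.Definitions using (Injective)

Even : ℕ → Set
Even k = k % 2 ≡ 0

Odd : ℕ → Set
Odd k = k % 2 ≡ 1

record Graph (n : ℕ) : Set₁ where
  field
    E      : Fin n → Fin n → Set
    E-sym  : ∀ {u v} → E u v → E v u
    E-irr  : ∀ {u} → ¬ E u u

record Matching {n : ℕ} (G : Graph n) : Set₁ where
  open Graph G
  field
    M       : Fin n → Fin n → Set
    M-sym   : ∀ {u v} → M u v → M v u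
    M⊆E     : ∀ {u v} → M u v → E u v
    M-uniq  : ∀ {u v w} → M u v → M u w → v ≡ w

module _ {n : ℕ} {G : Graph n} (MM : Matching G) where
  open Graph G
  open Matching MM

  Unmatched : Fin n → Set
  Unmatched v = ∀ w → ¬ M v w

  -- An alternating path of length k (k edges) from some unmatched vertex to v:
  -- a simple path v₀ … v_k with v₀ unmatched, v_k = v, whose i-th edge
  -- (0-indexed) is unmatched for even i and matched for odd i.
  record AltPath (v : Fin n) (k : ℕ) : Set where
    field
      vs      : Vec (Fin n) (suc k)
      start   : Unmatched (lookup vs zero)
      end     : lookup vs (fromℕ k) ≡ v
      simple  : Injective _≡_ _≡_ (lookup vs)
      edges   : ∀ (i : Fin k) → E (lookup vs (inject₁ i)) (lookup vs (suc i))
      altEven : ∀ (i : Fin k) → Even (toℕ i) → ¬ M (lookup vs (inject₁ i)) (lookup vs (suc i))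
      altOdd  : ∀ (i : Fin k) → Odd (toℕ i) → M (lookup vs (inject₁ i)) (lookup vs (suc i))

data ℕ∞ : Set where
  fin : ℕ → ℕ∞
  ∞   : ℕ∞

infixl 6 _⊕_
_⊕_ : ℕ∞ → ℕ∞ → ℕ∞
fin a ⊕ fin b = fin (a + b)
fin _ ⊕ ∞     = ∞
∞     ⊕ _     = ∞

module _ {n : ℕ} {G : Graph n} (MM : Matching G) where

  data MinLevel (P : ℕ → Set) (v : Fin n) : ℕ∞ → Set where
    finite   : ∀ k → P k → AltPath MM v k →
               (∀ k' → P k' → AltPath MM v k' → k ≤ k') → MinLevel P v (fin k)
    infinite : (∀ k → P k → ¬ AltPath MM v k) → MinLevel P v ∞

  EvenLevel : Fin n → ℕ∞ → Set
  EvenLevel = MinLevel Even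

  OddLevel : Fin n → ℕ∞ → Set
  OddLevel = MinLevel Odd

-- An odd alternating path to u ends with an unmatched edge, so appending the matched edge uv
-- gives an even alternating path to v: the partner v cannot already lie on the path, since every
-- inner vertex of an alternating path is matched to one of its neighbours on the path. Conversely
-- an even alternating path to v ends with its matched edge, which must be uv, so dropping it gives
-- an odd path to u. Hence evenlevel(v) = oddlevel(u) + 1 and symmetrically
-- evenlevel(u) = oddlevel(v) + 1, and both tenacities equal oddlevel(u) + oddlevel(v) + 1.
module Submission where

open import Defs
open import Data.Fin using (Fin)
open import Data.Product using (∃; _×_)
open import Relation.Binary.PropositionalEquality using (_≡_)

open import Data.Nat using (ℕ; zero; suc; _≤_; s≤s)
open import Data.Nat.Properties using (≤-antisym; +-comm; +-assoc)
open import Data.Fin using (zero; suc; toℕ; fromℕ; inject₁)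
open import Data.Fin.Properties using (toℕ-fromℕ; toℕ-inject₁; inject₁-injective; fromℕ≢inject₁)
open import Data.Fin.Relation.Unary.Top using (view; ‵fromℕ; ‵inject₁)
open import Data.Vec using (Vec; []; _∷_; lookup; tabulate; _∷ʳ_)
open import Data.Vec.Properties using (lookup∘tabulate)
open import Data.Product using (_,_)
open import Data.Sum using (_⊎_; inj₁; inj₂)
open import Data.Unit using (⊤; tt)
open import Data.Empty using (⊥-elim)
open import Relation.Nullary using (¬_)
open import Relation.Binary.PropositionalEquality
  using (_≢_; refl; sym; trans; cong; subst; subst₂; module ≡-Reasoning)
open import Function using (_∘_)
open import Function.Definitions using (Injective)

even⇒odd-suc : ∀ k → Even k → Odd (suc k)
even⇒odd-suc zero          _ = refl
even⇒odd-suc (suc zero)    ()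
even⇒odd-suc (suc (suc k)) e = even⇒odd-suc k e

odd⇒even-suc : ∀ k → Odd k → Even (suc k)
odd⇒even-suc zero          ()
odd⇒even-suc (suc zero)    _ = refl
odd⇒even-suc (suc (suc k)) o = odd⇒even-suc k o

even-suc⇒odd : ∀ k → Even (suc k) → Odd k
even-suc⇒odd zero          ()
even-suc⇒odd (suc zero)    _ = refl
even-suc⇒odd (suc (suc k)) e = even-suc⇒odd k e

even⊎odd : ∀ k → Even k ⊎ Odd k
even⊎odd zero          = inj₁ refl
even⊎odd (suc zero)    = inj₂ refl
even⊎odd (suc (suc k)) = even⊎odd k

even⇒¬odd : ∀ k → Even k → ¬ Odd k
even⇒¬odd _ e o with () ← trans (sym e) o

lookup-∷ʳ-inject₁ : ∀ {A : Set} {k} (xs : Vec A k) x (i : Fin k) →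
                    lookup (xs ∷ʳ x) (inject₁ i) ≡ lookup xs i
lookup-∷ʳ-inject₁ (y ∷ ys) x zero    = refl
lookup-∷ʳ-inject₁ (y ∷ ys) x (suc i) = lookup-∷ʳ-inject₁ ys x i

lookup-∷ʳ-fromℕ : ∀ {A : Set} {k} (xs : Vec A k) x → lookup (xs ∷ʳ x) (fromℕ k) ≡ x
lookup-∷ʳ-fromℕ []       x = refl
lookup-∷ʳ-fromℕ (y ∷ ys) x = lookup-∷ʳ-fromℕ ys x

⊕-comm : ∀ a b → a ⊕ b ≡ b ⊕ a
⊕-comm (fin a) (fin b) = cong fin (+-comm a b)
⊕-comm (fin a) ∞       = refl
⊕-comm ∞       (fin b) = refl
⊕-comm ∞       ∞       = refl

⊕-assoc : ∀ a b c → a ⊕ b ⊕ c ≡ a ⊕ (b ⊕ c)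
⊕-assoc (fin a) (fin b) (fin c) = cong fin (+-assoc a b c)
⊕-assoc (fin a) (fin b) ∞       = refl
⊕-assoc (fin a) ∞       c       = refl
⊕-assoc ∞       b       c       = refl

⊕-right-comm : ∀ a b c → a ⊕ b ⊕ c ≡ a ⊕ c ⊕ b
⊕-right-comm a b c = begin
  a ⊕ b ⊕ c    ≡⟨ ⊕-assoc a b c ⟩
  a ⊕ (b ⊕ c)  ≡⟨ cong (a ⊕_) (⊕-comm b c) ⟩
  a ⊕ (c ⊕ b)  ≡⟨ sym (⊕-assoc a c b) ⟩
  a ⊕ c ⊕ b    ∎
  where open ≡-Reasoning

module _ {n : ℕ} {G : Graph n} (MM : Matching G) where
  open Graph G
  open Matching MM

  empty-path⇒unmatched : ∀ {v} → AltPath MM v 0 → Unmatched MM v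
  empty-path⇒unmatched p = subst (Unmatched MM) (AltPath.end p) (AltPath.start p)

  penultimate : ∀ {v k} → AltPath MM v (suc k) → Fin n
  penultimate {k = k} p = lookup (AltPath.vs p) (inject₁ (fromℕ k))

  init : ∀ {v k} (p : AltPath MM v (suc k)) → AltPath MM (penultimate p) k
  init {k = k} p = record
    { vs      = ws
    ; start   = subst (Unmatched MM) (sym (ws-lookup zero)) start
    ; end     = ws-lookup (fromℕ k)
    ; simple  = λ {i} {j} eq →
        inject₁-injective (simple (trans (sym (ws-lookup i)) (trans eq (ws-lookup j))))
    ; edges   = λ i → prefix-edge E i (edges (inject₁ i))
    ; altEven = λ i e → prefix-edge (λ x y → ¬ M x y) i
                          (altEven (inject₁ i) (subst Even (sym (toℕ-inject₁ i)) e))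
    ; altOdd  = λ i o → prefix-edge M i
                          (altOdd (inject₁ i) (subst Odd (sym (toℕ-inject₁ i)) o))
    }
    where
    open AltPath p
    ws : Vec (Fin n) (suc k)
    ws = tabulate (lookup vs ∘ inject₁)
    ws-lookup : ∀ i → lookup ws i ≡ lookup vs (inject₁ i)
    ws-lookup = lookup∘tabulate (lookup vs ∘ inject₁)
    prefix-edge : (R : Fin n → Fin n → Set) (i : Fin k) →
                  R (lookup vs (inject₁ (inject₁ i))) (lookup vs (suc (inject₁ i))) →
                  R (lookup ws (inject₁ i)) (lookup ws (suc i))
    prefix-edge R i = subst₂ R (sym (ws-lookup (inject₁ i))) (sym (ws-lookup (suc i)))

  last-edge-matched : ∀ {v k} (p : AltPath MM v (suc k)) → Even (suc k) → M (penultimate p) v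
  last-edge-matched {k = k} p e =
    subst (M _) end (altOdd (fromℕ k) (subst Odd (sym (toℕ-fromℕ k)) (even-suc⇒odd k e)))
    where open AltPath p

  snoc : ∀ {u v k} (p : AltPath MM u k) → (∀ i → lookup (AltPath.vs p) i ≢ v) →
         E u v → (Even k → ¬ M u v) → (Odd k → M u v) → AltPath MM v (suc k)
  snoc {u} {v} {k} p v∉p uv unmatched-if-even matched-if-odd = record
    { vs      = ws
    ; start   = subst (Unmatched MM) (sym (ws-old zero)) start
    ; end     = ws-new
    ; simple  = simple′
    ; edges   = λ i → extend-edge (λ _ → ⊤) E (λ _ → uv) (λ j _ → edges j) i tt
    ; altEven = extend-edge Even (λ x y → ¬ M x y) unmatched-if-even altEven
    ; altOdd  = extend-edge Odd M matched-if-odd altOdd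
    }
    where
    open AltPath p
    ws : Vec (Fin n) (suc (suc k))
    ws = vs ∷ʳ v
    ws-old : ∀ i → lookup ws (inject₁ i) ≡ lookup vs i
    ws-old = lookup-∷ʳ-inject₁ vs v
    ws-new : lookup ws (fromℕ (suc k)) ≡ v
    ws-new = lookup-∷ʳ-fromℕ vs v

    simple′ : Injective _≡_ _≡_ (lookup ws)
    simple′ {i} {j} eq with view i | view j
    ... | ‵fromℕ     | ‵fromℕ     = refl
    ... | ‵fromℕ     | ‵inject₁ b = ⊥-elim (v∉p b (trans (sym (ws-old b)) (trans (sym eq) ws-new)))
    ... | ‵inject₁ a | ‵fromℕ     = ⊥-elim (v∉p a (trans (sym (ws-old a)) (trans eq ws-new)))
    ... | ‵inject₁ a | ‵inject₁ b =
          cong inject₁ (simple (trans (sym (ws-old a)) (trans eq (ws-old b))))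

    extend-edge : (P : ℕ → Set) (R : Fin n → Fin n → Set) → (P k → R u v) →
                  (∀ i → P (toℕ i) → R (lookup vs (inject₁ i)) (lookup vs (suc i))) →
                  ∀ i → P (toℕ i) → R (lookup ws (inject₁ i)) (lookup ws (suc i))
    extend-edge P R new old i Pi with view i
    ... | ‵fromℕ     = subst₂ R (sym (trans (ws-old (fromℕ k)) end)) (sym ws-new)
                         (new (subst P (toℕ-fromℕ k) Pi))
    ... | ‵inject₁ j = subst₂ R (sym (ws-old (inject₁ j))) (sym (ws-old (suc j)))
                         (old j (subst P (toℕ-inject₁ j) Pi))

  partner-∉-odd-path : ∀ {u v k} (p : AltPath MM u k) → Odd k → M u v →
                       ∀ i → lookup (AltPath.vs p) i ≢ v
  partner-∉-odd-path {u} {v} {k} p odd-k uv i vsᵢ≡v with view i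
  ... | ‵fromℕ     = E-irr (subst (E u) (trans (sym vsᵢ≡v) (AltPath.end p)) (M⊆E uv))
  ... | ‵inject₁ j = inner j vsᵢ≡v
    where
    open AltPath p
    at-end : ∀ {a} → lookup vs a ≡ u → a ≡ fromℕ k
    at-end eq = simple (trans eq (sym end))
    partner-of-v : ∀ {w x} → M w x → w ≡ v → x ≡ u
    partner-of-v wx refl = M-uniq wx (M-sym uv)

    -- v is matched to u, so the matched path edge at v would have to lead to u, i.e. to the end.
    inner : (j : Fin k) → lookup vs (inject₁ j) ≢ v
    inner zero    eq = start u (subst (λ x → M x u) (sym eq) (M-sym uv))
    inner (suc j) eq with even⊎odd (toℕ j)
    ... | inj₁ even-j = even⇒¬odd k (subst Even k≡ even-j) odd-k
      where
      k≡ : suc (suc (toℕ j)) ≡ k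
      k≡ = trans (cong toℕ (at-end (partner-of-v
             (altOdd (suc j) (even⇒odd-suc (toℕ j) even-j)) eq))) (toℕ-fromℕ k)
    ... | inj₂ odd-j = fromℕ≢inject₁ (sym (at-end (partner-of-v
             (M-sym (altOdd (inject₁ j) (subst Odd (sym (toℕ-inject₁ j)) odd-j))) eq)))

  extend-to-partner : ∀ {u v k} → M u v → AltPath MM u k → Odd k → AltPath MM v (suc k)
  extend-to-partner {k = k} uv p odd-k =
    snoc p (partner-∉-odd-path p odd-k uv) (M⊆E uv) (λ even-k _ → even⇒¬odd k even-k odd-k) (λ _ → uv)

  shorten-to-partner : ∀ {u v k} → M u v → AltPath MM v (suc k) → Even (suc k) → AltPath MM u k
  shorten-to-partner {k = k} uv p e =
    subst (λ w → AltPath MM w k) (M-uniq (M-sym (last-edge-matched p e)) (M-sym uv)) (init p)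

  evenlevel-of-partner : ∀ {u v e o} → M u v → EvenLevel MM v e → OddLevel MM u o → e ≡ o ⊕ fin 1
  evenlevel-of-partner uv (finite zero _ pv _) _ = ⊥-elim (empty-path⇒unmatched pv _ (M-sym uv))
  evenlevel-of-partner uv (finite (suc j) even-j pv min-v) (finite k odd-k pu min-u) =
    cong fin (trans (≤-antisym j≤k k≤j) (+-comm 1 k))
    where
    j≤k : suc j ≤ suc k
    j≤k = min-v (suc k) (odd⇒even-suc k odd-k) (extend-to-partner uv pu odd-k)
    k≤j : suc k ≤ suc j
    k≤j = s≤s (min-u j (even-suc⇒odd j even-j) (shorten-to-partner uv pv even-j))
  evenlevel-of-partner uv (finite (suc j) even-j pv _) (infinite no-u) =
    ⊥-elim (no-u j (even-suc⇒odd j even-j) (shorten-to-partner uv pv even-j))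
  evenlevel-of-partner uv (infinite no-v) (finite k odd-k pu _) =
    ⊥-elim (no-v (suc k) (odd⇒even-suc k odd-k) (extend-to-partner uv pu odd-k))
  evenlevel-of-partner uv (infinite _) (infinite _) = refl

lemma1 : ∀ {n} (G : Graph n) (MM : Matching G) →
    ∃ (λ w → Unmatched MM w) →
    ∀ (u v : Fin n) → Matching.M MM u v →
    ∀ eu ou ev ov →
    EvenLevel MM u eu → OddLevel MM u ou →
    EvenLevel MM v ev → OddLevel MM v ov →
    (eu ⊕ ou ≡ ev ⊕ ov) × (ev ⊕ ov ≡ ou ⊕ ov ⊕ fin 1)
lemma1 G MM _ u v uv eu ou ev ov Eu Ou Ev Ov
  with refl ← evenlevel-of-partner MM (Matching.M-sym MM uv) Eu Ov
     | refl ← evenlevel-of-partner MM uv Ev Ou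
  = t-u≡t-v , ⊕-right-comm ou (fin 1) ov
  where
  open ≡-Reasoning
  t-u≡t-v : ov ⊕ fin 1 ⊕ ou ≡ ou ⊕ fin 1 ⊕ ov
  t-u≡t-v = begin
    ov ⊕ fin 1 ⊕ ou  ≡⟨ ⊕-right-comm ov (fin 1) ou ⟩
    ov ⊕ ou ⊕ fin 1  ≡⟨ cong (_⊕ fin 1) (⊕-comm ov ou) ⟩
    ou ⊕ ov ⊕ fin 1  ≡⟨ ⊕-right-comm ou ov (fin 1) ⟩
    ou ⊕ fin 1 ⊕ ov  ∎
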